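{- Let $\mathcal V$ be a subtractive Fregean variety. Then the following are equivalent: (1) every $\mathcal V$-unifiable term is $\mathcal V$-projective; (2) $\mathcal V$ has projective unifiers; (3) every finite $\mathcal V$-unifiable set of equations is $\mathcal V$-projective.
   Context: A variety $\mathcal V$ of signature $\mathcal F$ with a distinguished constant $1$ is Fregean if every $\mathbf A\in\mathcal V$ is $1$-regular (congruences with the same $1$-coset are equal) and congruence orderable ($\Theta_{\mathbf A}(1,a)=\Theta_{\mathbf A}(1,b)$ implies $a=b$). Subtractive: there is a binary term $\mathsf s$ with $\mathcal V\models\mathsf s(x,x)\approx1$, $\mathsf s(1,x)\approx x$. $T_{\mathcal F}(n)$ is the term algebra in $x_1,\dots,x_n$, $\mathbf F_n$ the free algebra on $\mathbf x_1,\dots,\mathbf x_n$, $\mathbf t$ the class of $t$. A finite set $\{s_i=t_i: i=1,\dots,k\}$, $s_i,t_i\in T_{\mathcal F}(n)$, is $\mathcal V$-unifiable if there is a homomorphism $\sigma:\mathbf F_n\to\mathbf F_m$ with $\sigma(\mathbf s_i)=\sigma(\mathbf t_i)$ for all $i$, and $\mathcal V$-projective if there is an endomorphism $\tau$ of $\mathbf F_n$ with $\tau(\mathbf s_i)=\tau(\mathbf t_i)$ for all $i$ and $(\tau(\mathbf x_j),\mathbf x_j)\in\bigvee_{i=1}^k\Theta(\mathbf s_i,\mathbf t_i)$ for all $j$. A pair $(s,t)$ is unifiable/projective if the one-element set $\{s=t\}$ is; a term $t$ is unifiable/projective if $(t,1)$ is. $\mathcal V$ has projective unifiers if every unifiable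 pair of terms is projective (has a projective unifier). -}

module Defs where

open import Data.Nat using (ℕ; zero; suc)
open import Data.Fin using (Fin; zero; suc)
open import Data.Product using (Σ; ∃; _×_; _,_; proj₁; proj₂)
open import Relation.Binary.PropositionalEquality using (_≡_; subst)
open import Relation.Binary.Structures using (IsEquivalence)

record Signature : Set₁ where
  field
    Op      : Set
    ar      : Op → ℕ
    one     : Op
    one-ar  : ar one ≡ 0

noFin : {A : Set} → Fin 0 → A
noFin ()

module Over (S : Signature) where
  open Signature S

  noArgs : {A : Set} → Fin (ar one) → A
  noArgs i = noFin (subst Fin one-ar i)

  data Term (X : Set) : Set where
    var : X → Term X
    app : (f : Op) → (Fin (ar f) → Term X) → Term X

  𝟏 : {X : Set} → Term X
  𝟏 = app one noArgs

  _[_] : {X Y : Set} → Term X → (X → Term Y) → Term Y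
  var x [ σ ]    = σ x
  app f ts [ σ ] = app f (λ i → ts i [ σ ])

  record Algebra : Set₁ where
    field
      Carrier : Set
      _≈_     : Carrier → Carrier → Set
      isEquiv : IsEquivalence _≈_
      op      : (f : Op) → (Fin (ar f) → Carrier) → Carrier
      op-cong : ∀ f {as bs : Fin (ar f) → Carrier} →
                (∀ i → as i ≈ bs i) → op f as ≈ op f bs

    1A : Carrier
    1A = op one noArgs

    eval : {X : Set} → (X → Carrier) → Term X → Carrier
    eval ρ (var x)    = ρ x
    eval ρ (app f ts) = op f (λ i → eval ρ (ts i))

  module _ (A : Algebra) where
    open Algebra A

    record IsCongruence (θ : Carrier → Carrier → Set) : Set where
      field
        equiv  : IsEquivalence θ
        ≈⊆θ    : ∀ {a b} → a ≈ b → θ a b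
        compat : ∀ f {as bs : Fin (ar f) → Carrier} →
                 (∀ i → θ (as i) (bs i)) → θ (op f as) (op f bs)

    data Cg (R : Carrier → Carrier → Set) : Carrier → Carrier → Set where
      base   : ∀ {a b} → R a b → Cg R a b
      ≈-in   : ∀ {a b} → a ≈ b → Cg R a b
      sym′   : ∀ {a b} → Cg R a b → Cg R b a
      trans′ : ∀ {a b c} → Cg R a b → Cg R b c → Cg R a c
      compat : ∀ f {as bs : Fin (ar f) → Carrier} →
               (∀ i → Cg R (as i) (bs i)) → Cg R (op f as) (op f bs)

    Θ : Carrier → Carrier → Carrier → Carrier → Set
    Θ a b = Cg (λ x y → (x ≡ a) × (y ≡ b))

    ⋁ : {k : ℕ} → (Fin k → Carrier → Carrier → Set) → Carrier → Carrier → Set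
    ⋁ θs = Cg (λ x y → ∃ λ i → θs i x y)

    OneRegular : Set₁
    OneRegular = (θ φ : Carrier → Carrier → Set) →
      IsCongruence θ → IsCongruence φ →
      (∀ a → (θ a 1A → φ a 1A) × (φ a 1A → θ a 1A)) →
      ∀ a b → (θ a b → φ a b) × (φ a b → θ a b)

    CongruenceOrderable : Set
    CongruenceOrderable = ∀ a b →
      (∀ x y → (Θ 1A a x y → Θ 1A b x y) × (Θ 1A b x y → Θ 1A a x y)) →
      a ≈ b

  record Hom (A B : Algebra) : Set where
    module A = Algebra A
    module B = Algebra B
    field
      map     : A.Carrier → B.Carrier
      map-cong : ∀ {a b} → a A.≈ b → map a B.≈ map b
      map-op  : ∀ f (as : Fin (ar f) → A.Carrier) →
                map (A.op f as) B.≈ B.op f (λ i → map (as i))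

  record Variety : Set₁ where
    field
      Ax  : Set
      lhs : Ax → Term ℕ
      rhs : Ax → Term ℕ

  module _ (V : Variety) where
    open Variety V

    _∈V : Algebra → Set
    A ∈V = ∀ (e : Ax) (ρ : ℕ → Algebra.Carrier A) →
           Algebra._≈_ A (Algebra.eval A ρ (lhs e)) (Algebra.eval A ρ (rhs e))

    -- V ⊨ s ≈ t  (equational consequence, via the complete Birkhoff rules)
    data _⊨_≈_ {X : Set} : Term X → Term X → Set where
      ⊨refl  : ∀ {t} → _⊨_≈_ t t
      ⊨sym   : ∀ {s t} → _⊨_≈_ s t → _⊨_≈_ t s
      ⊨trans : ∀ {s t u} → _⊨_≈_ s t → _⊨_≈_ t u → _⊨_≈_ s u
      ⊨cong  : ∀ f {ts us : Fin (ar f) → Term X} →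
               (∀ i → _⊨_≈_ (ts i) (us i)) → _⊨_≈_ (app f ts) (app f us)
      ⊨ax    : ∀ (e : Ax) (σ : ℕ → Term X) → _⊨_≈_ (lhs e [ σ ]) (rhs e [ σ ])

    Fregean : Set₁
    Fregean = ∀ (A : Algebra) → A ∈V → OneRegular A × CongruenceOrderable A

    Subtractive : Set
    Subtractive = Σ (Term (Fin 2)) λ s →
      (_⊨_≈_ {Fin 1} (s [ xx ]) 𝟏) ×
      (_⊨_≈_ {Fin 1} (s [ 1x ]) (var zero))
      where
      -- s(x,x) and s(1,x), with x the single variable of T(1)
      xx : Fin 2 → Term (Fin 1)
      xx _ = var zero
      1x : Fin 2 → Term (Fin 1)
      1x zero    = 𝟏
      1x (suc _) = var zero

    F : ℕ → Algebra
    F n = record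
      { Carrier = Term (Fin n)
      ; _≈_     = _⊨_≈_
      ; isEquiv = record { refl = ⊨refl ; sym = ⊨sym ; trans = ⊨trans }
      ; op      = app
      ; op-cong = ⊨cong
      }

    Equations : ℕ → ℕ → Set
    Equations n k = Fin k → Term (Fin n) × Term (Fin n)

    Unifiable : {n k : ℕ} → Equations n k → Set
    Unifiable {n} eqs = Σ ℕ λ m → Σ (Hom (F n) (F m)) λ σ →
      ∀ i → _⊨_≈_ (Hom.map σ (proj₁ (eqs i))) (Hom.map σ (proj₂ (eqs i)))

    Projective : {n k : ℕ} → Equations n k → Set
    Projective {n} eqs = Σ (Hom (F n) (F n)) λ τ →
      (∀ i → _⊨_≈_ (Hom.map τ (proj₁ (eqs i))) (Hom.map τ (proj₂ (eqs i)))) ×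
      (∀ (j : Fin n) → ⋁ (F n) (λ i → Θ (F n) (proj₁ (eqs i)) (proj₂ (eqs i)))
                         (Hom.map τ (var j)) (var j))

    single : {n : ℕ} → Term (Fin n) → Term (Fin n) → Equations n 1
    single s t _ = s , t

    UnifiablePair ProjectivePair : {n : ℕ} → Term (Fin n) → Term (Fin n) → Set
    UnifiablePair s t = Unifiable (single s t)
    ProjectivePair s t = Projective (single s t)

    UnifiableTerm ProjectiveTerm : {n : ℕ} → Term (Fin n) → Set
    UnifiableTerm t = UnifiablePair t 𝟏
    ProjectiveTerm t = ProjectivePair t 𝟏

    UnifiableTermsProjective : Set
    UnifiableTermsProjective = ∀ n (t : Term (Fin n)) →
      UnifiableTerm t → ProjectiveTerm t

    HasProjectiveUnifiers : Set
    HasProjectiveUnifiers = ∀ n (s t : Term (Fin n)) →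
      UnifiablePair s t → ProjectivePair s t

    UnifiableSetsProjective : Set
    UnifiableSetsProjective = ∀ n k (eqs : Equations n k) →
      Unifiable eqs → Projective eqs

-- Projective unifiers are built by composition.  For a finite set of equations,
-- take a projective unifier τ₁ of the first equation; since τ₁ moves each
-- variable only within the congruence generated by that equation, every
-- unifier σ of the whole set satisfies σ ∘ τ₁ = σ, so σ still unifies the
-- τ₁-images of the remaining equations, and induction supplies τ₂.  For a pair
-- (u, v), write a ∸ b for the subtraction term s(a, b) and compose projective
-- unifiers τ₁ of u ∸ v and τ₂ of τ₁(v ∸ u); then τ = τ₂ ∘ τ₁ sends both u ∸ v
-- and v ∸ u to 1.  In a Fregean variety this forces τ u = τ v: q ∸ p = 1 gives
-- Θ(1, p) ⊆ Θ(1, q), and congruence orderability applies in the free algebra.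
module Submission where

open import Defs
open import Data.Nat using (ℕ; zero; suc)
open import Data.Fin using (Fin; zero; suc)
open import Data.Product using (_×_; _,_; proj₁; proj₂)
open import Relation.Binary.PropositionalEquality using (refl; subst)
open import Relation.Binary.Structures using (IsEquivalence)
open import Data.Vec.Functional using ([]; _∷_)
open import Relation.Binary.Bundles using (Setoid)
import Relation.Binary.Reasoning.Setoid as ≋-Reasoning

module _ {S : Signature} where
  open Signature S
  open Over S

  module _ (A : Algebra) where
    open Algebra A

    Cg-isCongruence : (R : Carrier → Carrier → Set) → IsCongruence A (Cg A R)
    Cg-isCongruence R = record
      { equiv  = record { refl = ≈-in (IsEquivalence.refl isEquiv) ; sym = sym′ ; trans = trans′ }
      ; ≈⊆θ    = ≈-in
      ; compat = compat
      }

    Cg-least : ∀ {R θ} → IsCongruence A θ → (∀ {a b} → R a b → θ a b) →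
               ∀ {a b} → Cg A R a b → θ a b
    Cg-least θ-cong R⊆θ (base r)      = R⊆θ r
    Cg-least θ-cong R⊆θ (≈-in e)      = IsCongruence.≈⊆θ θ-cong e
    Cg-least θ-cong R⊆θ (sym′ p)      = IsEquivalence.sym (IsCongruence.equiv θ-cong) (Cg-least θ-cong R⊆θ p)
    Cg-least θ-cong R⊆θ (trans′ p q)  =
      IsEquivalence.trans (IsCongruence.equiv θ-cong) (Cg-least θ-cong R⊆θ p) (Cg-least θ-cong R⊆θ q)
    Cg-least θ-cong R⊆θ (compat f ps) = IsCongruence.compat θ-cong f (λ i → Cg-least θ-cong R⊆θ (ps i))

  ker-isCongruence : {A B : Algebra} (h : Hom A B) →
                     IsCongruence A (λ a b → Algebra._≈_ B (Hom.map h a) (Hom.map h b))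
  ker-isCongruence {A} {B} h = record
    { equiv  = record { refl = ≈.refl ; sym = ≈.sym ; trans = ≈.trans }
    ; ≈⊆θ    = map-cong
    ; compat = λ f {as} {bs} ps →
        ≈.trans (map-op f as) (≈.trans (Algebra.op-cong B f ps) (≈.sym (map-op f bs)))
    }
    where
    open Hom h
    module ≈ = IsEquivalence (Algebra.isEquiv B)

  module _ (V : Variety) where

    infix 4 _≋_
    _≋_ : {X : Set} → Term X → Term X → Set
    s ≋ t = V ⊨ s ≈ t

    ≋-setoid : Set → Setoid _ _
    ≋-setoid X = record
      { Carrier       = Term X
      ; _≈_           = _≋_
      ; isEquivalence = record { refl = ⊨refl ; sym = ⊨sym ; trans = ⊨trans }
      }

    subst-cong : {X Y : Set} (t : Term X) {ρ ρ′ : X → Term Y} →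
                 (∀ x → ρ x ≋ ρ′ x) → t [ ρ ] ≋ t [ ρ′ ]
    subst-cong (var x)    e = e x
    subst-cong (app f ts) e = ⊨cong f (λ i → subst-cong (ts i) e)

    subst-assoc : {X Y Z : Set} (t : Term X) (σ : X → Term Y) (ρ : Y → Term Z) →
                  (t [ σ ]) [ ρ ] ≋ t [ (λ x → σ x [ ρ ]) ]
    subst-assoc (var x)    σ ρ = ⊨refl
    subst-assoc (app f ts) σ ρ = ⊨cong f (λ i → subst-assoc (ts i) σ ρ)

    ⊨-subst : {X Y : Set} {s t : Term X} (ρ : X → Term Y) → s ≋ t → s [ ρ ] ≋ t [ ρ ]
    ⊨-subst ρ ⊨refl        = ⊨refl
    ⊨-subst ρ (⊨sym p)     = ⊨sym (⊨-subst ρ p)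
    ⊨-subst ρ (⊨trans p q) = ⊨trans (⊨-subst ρ p) (⊨-subst ρ q)
    ⊨-subst ρ (⊨cong f ps) = ⊨cong f (λ i → ⊨-subst ρ (ps i))
    ⊨-subst ρ (⊨ax e σ)    =
      ⊨trans (subst-assoc (Variety.lhs V e) σ ρ)
        (⊨trans (⊨ax e _) (⊨sym (subst-assoc (Variety.rhs V e) σ ρ)))

    𝟏-subst : {X Y : Set} (ρ : X → Term Y) → 𝟏 [ ρ ] ≋ 𝟏
    𝟏-subst ρ = ⊨cong one (λ i → noFin (subst Fin one-ar i))

    eval-F : ∀ {n} {X : Set} (ρ : X → Term (Fin n)) (t : Term X) →
             Algebra.eval (F V n) ρ t ≋ t [ ρ ]
    eval-F ρ (var x)    = ⊨refl
    eval-F ρ (app f ts) = ⊨cong f (λ i → eval-F ρ (ts i))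

    F-∈V : ∀ n → _∈V V (F V n)
    F-∈V n e ρ = ⊨trans (eval-F ρ (Variety.lhs V e))
                   (⊨trans (⊨ax e ρ) (⊨sym (eval-F ρ (Variety.rhs V e))))

    module _ {n m : ℕ} (h : Hom (F V n) (F V m)) where
      open Hom h

      map-subst : {X : Set} (t : Term X) (ρ : X → Term (Fin n)) →
                  map (t [ ρ ]) ≋ t [ (λ x → map (ρ x)) ]
      map-subst (var x)    ρ = ⊨refl
      map-subst (app f ts) ρ = ⊨trans (map-op f _) (⊨cong f (λ i → map-subst (ts i) ρ))

      map-𝟏 : map 𝟏 ≋ 𝟏
      map-𝟏 = ⊨trans (map-op one noArgs) (⊨cong one (λ i → noFin (subst Fin one-ar i)))

    idₕ : ∀ {n} → Hom (F V n) (F V n)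
    idₕ = record { map = λ x → x ; map-cong = λ e → e ; map-op = λ f as → ⊨refl }

    infixr 9 _∘ₕ_
    _∘ₕ_ : ∀ {n m k} → Hom (F V m) (F V k) → Hom (F V n) (F V m) → Hom (F V n) (F V k)
    g ∘ₕ h = record
      { map      = λ x → Hom.map g (Hom.map h x)
      ; map-cong = λ e → Hom.map-cong g (Hom.map-cong h e)
      ; map-op   = λ f as → ⊨trans (Hom.map-cong g (Hom.map-op h f as)) (Hom.map-op g f _)
      }

    module _ {n : ℕ} {θ : Term (Fin n) → Term (Fin n) → Set} (θ-cong : IsCongruence (F V n) θ) where
      open IsEquivalence (IsCongruence.equiv θ-cong)

      subst-compat : {X : Set} (t : Term X) {ρ ρ′ : X → Term (Fin n)} →
                     (∀ x → θ (ρ x) (ρ′ x)) → θ (t [ ρ ]) (t [ ρ′ ])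
      subst-compat (var x)    e = e x
      subst-compat (app f ts) e = IsCongruence.compat θ-cong f (λ i → subst-compat (ts i) e)

      fixes-vars⇒fixes : (τ : Hom (F V n) (F V n)) →
                         (∀ j → θ (Hom.map τ (var j)) (var j)) → ∀ u → θ (Hom.map τ u) u
      fixes-vars⇒fixes τ fixes (var j)    = fixes j
      fixes-vars⇒fixes τ fixes (app f ts) =
        trans (IsCongruence.≈⊆θ θ-cong (Hom.map-op τ f ts))
              (IsCongruence.compat θ-cong f (λ i → fixes-vars⇒fixes τ fixes (ts i)))

      ∘-fixes-vars : (τ₁ τ₂ : Hom (F V n) (F V n)) →
                     (∀ j → θ (Hom.map τ₁ (var j)) (var j)) →
                     (∀ j → θ (Hom.map τ₂ (var j)) (var j)) →
                     ∀ j → θ (Hom.map (τ₂ ∘ₕ τ₁) (var j)) (var j)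
      ∘-fixes-vars τ₁ τ₂ fixes₁ fixes₂ j =
        trans (fixes-vars⇒fixes τ₂ fixes₂ (Hom.map τ₁ (var j))) (fixes₁ j)

    infix 4 _HoldIn_
    _HoldIn_ : ∀ {n k} → Equations V n k → (Term (Fin n) → Term (Fin n) → Set) → Set
    eqs HoldIn θ = ∀ i → θ (proj₁ (eqs i)) (proj₂ (eqs i))

    module _ {n k : ℕ} (eqs : Equations V n k) where

      Θ⟨_⟩ : Term (Fin n) → Term (Fin n) → Set
      Θ⟨_⟩ = ⋁ (F V n) (λ i → Θ (F V n) (proj₁ (eqs i)) (proj₂ (eqs i)))

      Unifies : ∀ {m} → Hom (F V n) (F V m) → Set
      Unifies σ = eqs HoldIn (λ a b → Hom.map σ a ≋ Hom.map σ b)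

      Θ⟨⟩-isCongruence : IsCongruence (F V n) Θ⟨_⟩
      Θ⟨⟩-isCongruence = Cg-isCongruence (F V n) _

      equations-holdIn-Θ⟨⟩ : eqs HoldIn Θ⟨_⟩
      equations-holdIn-Θ⟨⟩ i = base (i , base (refl , refl))

      Θ⟨⟩-least : ∀ {θ} → IsCongruence (F V n) θ → eqs HoldIn θ → ∀ {x y} → Θ⟨_⟩ x y → θ x y
      Θ⟨⟩-least θ-cong eqs⊆θ = Cg-least (F V n) θ-cong
        (λ { (i , p) → Cg-least (F V n) θ-cong (λ { (refl , refl) → eqs⊆θ i }) p })

      projective-fixes : (τ : Projective V eqs) → ∀ u → Θ⟨_⟩ (Hom.map (proj₁ τ) u) u
      projective-fixes (τ , _ , fixes) = fixes-vars⇒fixes Θ⟨⟩-isCongruence τ fixes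

      unifier-absorbs-projective : (τ : Projective V eqs) → ∀ {m} (σ : Hom (F V n) (F V m)) →
        Unifies σ → ∀ u → Hom.map σ (Hom.map (proj₁ τ) u) ≋ Hom.map σ u
      unifier-absorbs-projective τ σ σ-unif u =
        Θ⟨⟩-least (ker-isCongruence σ) σ-unif (projective-fixes τ u)

    Θ⟨⟩-mono : ∀ {n k k′} {eqs : Equations V n k} (eqs′ : Equations V n k′) →
               eqs′ HoldIn Θ⟨ eqs ⟩ → ∀ {x y} → Θ⟨ eqs′ ⟩ x y → Θ⟨ eqs ⟩ x y
    Θ⟨⟩-mono {eqs = eqs} eqs′ = Θ⟨⟩-least eqs′ (Θ⟨⟩-isCongruence eqs)

    module _ {n k k₁ : ℕ} {eqs : Equations V n k} {eqs₁ : Equations V n k₁}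
             (τ₁ : Projective V eqs₁) (eqs₁⊆ : eqs₁ HoldIn Θ⟨ eqs ⟩) where

      projective-preserves-Θ⟨⟩ : ∀ {a b} → Θ⟨ eqs ⟩ a b →
                                 Θ⟨ eqs ⟩ (Hom.map (proj₁ τ₁) a) (Hom.map (proj₁ τ₁) b)
      projective-preserves-Θ⟨⟩ p = trans′ (moved _) (trans′ p (sym′ (moved _)))
        where moved = λ u → Θ⟨⟩-mono eqs₁ eqs₁⊆ (projective-fixes eqs₁ τ₁ u)

      ∘-projective : ∀ {k₂} {eqs₂ : Equations V n k₂} (τ₂ : Projective V eqs₂) → eqs₂ HoldIn Θ⟨ eqs ⟩ →
        ∀ j → Θ⟨ eqs ⟩ (Hom.map (proj₁ τ₂ ∘ₕ proj₁ τ₁) (var j)) (var j)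
      ∘-projective {eqs₂ = eqs₂} τ₂ eqs₂⊆ =
        ∘-fixes-vars (Θ⟨⟩-isCongruence eqs) (proj₁ τ₁) (proj₁ τ₂)
          (λ j → Θ⟨⟩-mono eqs₁ eqs₁⊆ (proj₂ (proj₂ τ₁) j)) (λ j → Θ⟨⟩-mono eqs₂ eqs₂⊆ (proj₂ (proj₂ τ₂) j))

    infix 30 _⟪_⟫
    _⟪_⟫ : ∀ {n k} → Hom (F V n) (F V n) → Equations V n k → Equations V n k
    (τ ⟪ eqs ⟫) i = Hom.map τ (proj₁ (eqs i)) , Hom.map τ (proj₂ (eqs i))

    unifies-⟪⟫ : ∀ {n k₁ k₂ m} {eqs₁ : Equations V n k₁} {eqs₂ : Equations V n k₂}
      (τ : Projective V eqs₁) (σ : Hom (F V n) (F V m)) →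
      Unifies eqs₁ σ → Unifies eqs₂ σ → Unifies (proj₁ τ ⟪ eqs₂ ⟫) σ
    unifies-⟪⟫ {eqs₁ = eqs₁} τ σ σ-unif₁ σ-unif₂ i =
      ⊨trans (absorbs _) (⊨trans (σ-unif₂ i) (⊨sym (absorbs _)))
      where absorbs = unifier-absorbs-projective eqs₁ τ σ σ-unif₁

    projectiveUnifiers⇒setsProjective : HasProjectiveUnifiers V → UnifiableSetsProjective V
    projectiveUnifiers⇒setsProjective H n zero    eqs _ = idₕ , (λ ()) , (λ j → ≈-in ⊨refl)
    projectiveUnifiers⇒setsProjective H n (suc k) eqs (m , σ , σ-unif) =
      proj₁ τ₂ ∘ₕ proj₁ τ₁ , unifies , ∘-projective τ₁ head⊆ τ₂ tail⊆
      where
      head = single V (proj₁ (eqs zero)) (proj₂ (eqs zero))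
      tail : Equations V n k
      tail i = eqs (suc i)
      head⊆ : head HoldIn Θ⟨ eqs ⟩
      head⊆ _ = equations-holdIn-Θ⟨⟩ eqs zero
      τ₁ : Projective V head
      τ₁ = H n _ _ (m , σ , λ _ → σ-unif zero)
      tail⊆ : proj₁ τ₁ ⟪ tail ⟫ HoldIn Θ⟨ eqs ⟩
      tail⊆ i = projective-preserves-Θ⟨⟩ τ₁ head⊆ (equations-holdIn-Θ⟨⟩ eqs (suc i))
      τ₂ : Projective V (proj₁ τ₁ ⟪ tail ⟫)
      τ₂ = projectiveUnifiers⇒setsProjective H n k _
        (m , σ , unifies-⟪⟫ τ₁ σ (λ _ → σ-unif zero) (λ i → σ-unif (suc i)))
      unifies : Unifies eqs (proj₁ τ₂ ∘ₕ proj₁ τ₁)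
      unifies zero    = Hom.map-cong (proj₁ τ₂) (proj₁ (proj₂ τ₁) zero)
      unifies (suc i) = proj₁ (proj₂ τ₂) i

    setsProjective⇒termsProjective : UnifiableSetsProjective V → UnifiableTermsProjective V
    setsProjective⇒termsProjective H n t = H n 1 (single V t 𝟏)

    module _ (subtractive : Subtractive V) where
      private
        s = proj₁ subtractive

      infixl 6 _∸_
      _∸_ : ∀ {n} → Term (Fin n) → Term (Fin n) → Term (Fin n)
      u ∸ v = s [ u ∷ v ∷ [] ]

      ∸-self : ∀ {n} (u : Term (Fin n)) → u ∸ u ≋ 𝟏
      ∸-self {n} u = begin
        s [ u ∷ u ∷ [] ]                                 ≈⟨ subst-cong s (λ { zero → ⊨refl ; (suc zero) → ⊨refl }) ⟩
        s [ (λ _ → var {Fin 1} zero [ (λ _ → u) ]) ]   ≈⟨ ⊨sym (subst-assoc s _ (λ _ → u)) ⟩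
        (s [ (λ _ → var {Fin 1} zero) ]) [ (λ _ → u) ] ≈⟨ ⊨-subst (λ _ → u) (proj₁ (proj₂ subtractive)) ⟩
        𝟏 [ (λ _ → u) ]                                  ≈⟨ 𝟏-subst _ ⟩
        𝟏                                                ∎
        where open ≋-Reasoning (≋-setoid (Fin n))

      𝟏∸ : ∀ {n} (u : Term (Fin n)) → 𝟏 ∸ u ≋ u
      𝟏∸ u = ⊨trans (subst-cong s (λ { zero → ⊨sym (𝟏-subst _) ; (suc zero) → ⊨refl }))
               (⊨trans (⊨sym (subst-assoc s _ (λ _ → u))) (⊨-subst (λ _ → u) (proj₂ (proj₂ subtractive))))

      map-∸ : ∀ {n m} (h : Hom (F V n) (F V m)) u v → Hom.map h (u ∸ v) ≋ Hom.map h u ∸ Hom.map h v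
      map-∸ h u v = ⊨trans (map-subst h s _) (subst-cong s (λ { zero → ⊨refl ; (suc zero) → ⊨refl }))

      ∸-compat : ∀ {n θ} → IsCongruence (F V n) θ → ∀ {u u′ v v′} →
                 θ u u′ → θ v v′ → θ (u ∸ v) (u′ ∸ v′)
      ∸-compat θ-cong p q = subst-compat θ-cong s (λ { zero → p ; (suc zero) → q })

      ∸≋𝟏⇒Θ⊆ : ∀ {n} {p q : Term (Fin n)} → q ∸ p ≋ 𝟏 →
               ∀ {x y} → Θ (F V n) 𝟏 p x y → Θ (F V n) 𝟏 q x y
      ∸≋𝟏⇒Θ⊆ {n} {p} {q} q∸p≋𝟏 = Cg-least (F V n) θ-cong λ { (refl , refl) →
          sym′ (trans′ (≈-in (⊨sym (𝟏∸ p)))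
                (trans′ (∸-compat θ-cong (base (refl , refl)) (≈-in ⊨refl)) (≈-in q∸p≋𝟏))) }
        where θ-cong = Cg-isCongruence (F V n) _

      ∸-antisym : Fregean V → ∀ {n} {p q : Term (Fin n)} → p ∸ q ≋ 𝟏 → q ∸ p ≋ 𝟏 → p ≋ q
      ∸-antisym fregean {n} {p} {q} p∸q≋𝟏 q∸p≋𝟏 =
        proj₂ (fregean (F V n) (F-∈V n)) p q (λ x y → ∸≋𝟏⇒Θ⊆ q∸p≋𝟏 , ∸≋𝟏⇒Θ⊆ p∸q≋𝟏)

      termsProjective⇒projectiveUnifiers : Fregean V → UnifiableTermsProjective V → HasProjectiveUnifiers V
      termsProjective⇒projectiveUnifiers fregean H n u v (m , σ , σ-unif) =
        τ , (λ _ → unifies) , ∘-projective τ₁ first⊆ τ₂ second⊆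
        where
        σ-unifies-∸ : ∀ {a b} → Hom.map σ a ≋ Hom.map σ b → Hom.map σ (a ∸ b) ≋ Hom.map σ 𝟏
        σ-unifies-∸ {a} {b} σa≋σb =
          ⊨trans (map-∸ σ a b) (⊨trans (subst-cong s (λ { zero → σa≋σb ; (suc zero) → ⊨refl }))
            (⊨trans (∸-self _) (⊨sym (map-𝟏 σ))))
        θ-cong = Θ⟨⟩-isCongruence (single V u v)
        u≡v = equations-holdIn-Θ⟨⟩ (single V u v) zero
        first⊆ : single V (u ∸ v) 𝟏 HoldIn Θ⟨ single V u v ⟩
        first⊆ _ = trans′ (∸-compat θ-cong u≡v (≈-in ⊨refl)) (≈-in (∸-self v))
        τ₁ : Projective V (single V (u ∸ v) 𝟏)
        τ₁ = H n (u ∸ v) (m , σ , λ _ → σ-unifies-∸ (σ-unif zero))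
        v∸u′ = Hom.map (proj₁ τ₁) (v ∸ u)
        second⊆ : single V v∸u′ 𝟏 HoldIn Θ⟨ single V u v ⟩
        second⊆ _ = trans′ (projective-preserves-Θ⟨⟩ τ₁ first⊆
                              (trans′ (∸-compat θ-cong (sym′ u≡v) (≈-in ⊨refl)) (≈-in (∸-self u))))
                           (≈-in (map-𝟏 (proj₁ τ₁)))
        τ₂ : Projective V (single V v∸u′ 𝟏)
        τ₂ = H n v∸u′ (m , σ , λ _ →
          ⊨trans (unifier-absorbs-projective _ τ₁ σ (λ _ → σ-unifies-∸ (σ-unif zero)) (v ∸ u))
                 (σ-unifies-∸ (⊨sym (σ-unif zero))))
        τ = proj₁ τ₂ ∘ₕ proj₁ τ₁
        τ-∸ : ∀ {a b} → Hom.map τ (a ∸ b) ≋ 𝟏 → Hom.map τ a ∸ Hom.map τ b ≋ 𝟏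
        τ-∸ {a} {b} e = ⊨trans (⊨sym (map-∸ τ a b)) e
        unifies : Hom.map τ u ≋ Hom.map τ v
        unifies = ∸-antisym fregean
          (τ-∸ (⊨trans (Hom.map-cong (proj₁ τ₂) (proj₁ (proj₂ τ₁) zero)) (map-𝟏 τ)))
          (τ-∸ (⊨trans (proj₁ (proj₂ τ₂) zero) (map-𝟏 (proj₁ τ₂))))

mainTheorem9 : (S : Signature) → let open Over S in
    (V : Variety) → Subtractive V → Fregean V →
    (UnifiableTermsProjective V → HasProjectiveUnifiers V) ×
    (HasProjectiveUnifiers V → UnifiableSetsProjective V) ×
    (UnifiableSetsProjective V → UnifiableTermsProjective V)
mainTheorem9 S V subtractive fregean =
  termsProjective⇒projectiveUnifiers V subtractive fregean ,
  projectiveUnifiers⇒setsProjective V ,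
  setsProjective⇒termsProjective V
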